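{- Let $k\in\mathbb{N}$ and $S=\langle 6k+5,6k+7,6k+11\rangle$. Then \[\mathrm{Ap}(S,6k+5)=\{0,\,6k+7,\,6k+11\}\cup\{\,j(6k+11)-8,\ j(6k+11)-4,\ j(6k+11)\mid 2\le j\le 2k+1\,\}\cup\{(2k+2)(6k+11)-8,\ (2k+2)(6k+11)-4\}.\]
   Context: $\mathbb{N}=\{0,1,2,\dots\}$. For $X\subseteq\mathbb{N}$, $\langle X\rangle$ is the submonoid of $(\mathbb{N},+)$ generated by $X$; here it is a numerical semigroup. For a numerical semigroup $S$ and $n\in S\setminus\{0\}$, the Apéry set is $\mathrm{Ap}(S,n)=\{s\in S\mid s-n\notin S\}$. -}

module Defs where

open import Data.Nat using (ℕ; _+_; _*_; _∸_; _≤_)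
open import Data.Product using (Σ; ∃; _×_; _,_)
open import Relation.Binary.PropositionalEquality using (_≡_)
open import Relation.Nullary using (¬_)

InGen3 : ℕ → ℕ → ℕ → ℕ → Set
InGen3 a b c s = ∃ λ x → ∃ λ y → ∃ λ z → x * a + y * b + z * c ≡ s

-- a numerical semigroup given as a membership predicate on ℕ
-- Apéry set Ap(S,n) = { s ∈ S | s - n ∉ S }; "s - n ∈ S" for s - n ∈ ℤ means n ≤ s and s ∸ n ∈ S
InApery : (ℕ → Set) → ℕ → ℕ → Set
InApery S n s = S s × ¬ (n ≤ s × S (s ∸ n))

{-# OPTIONS --safe #-}
module Submission where

-- Write a, b, c for the generators 6k+5, 6k+7, 6k+11. The relations 3b = 2a + c,
-- (2k+2)c = (2k+3)a + b and 2b + (2k+1)c = (2k+5)a rewrite every element of S as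
-- x·a + (y·b + z·c) with (y, z) reduced: y ≤ 2 and z ≤ 2k+1, or z ≤ 2k when y = 2.
-- Since b = a + 2 and c = a + 6, y·b + z·c = (y+z)·a + 2(y + 3z) with y + 3z < a,
-- and a is odd, so two reduced elements never differ by a positive multiple of a.
-- Hence Ap(S, a) consists of the reduced elements, and y·b + z·c = (y+z)·c − 4y
-- lists them.

open import Defs
open import Data.Empty using (⊥-elim)
open import Data.List using (_∷_; [])
open import Data.Nat using (ℕ; zero; suc; _+_; _*_; _∸_; _≤_; _<_; z≤n; s≤s; s≤s⁻¹; z<s; NonZero)
open import Data.Nat.DivMod using (_%_; [m+kn]%n≡m%n; m<n⇒m%n≡m)
open import Data.Nat.Properties
open import Algebra.Properties.CommutativeSemigroup +-commutativeSemigroup using (x∙yz≈y∙xz)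
open import Data.Nat.Tactic.RingSolver using (solve)
open import Data.Product using (∃; ∃₂; _×_; _,_)
open import Data.Sum using (_⊎_; inj₁; inj₂)
open import Function.Bundles using (_⇔_; mk⇔)
open import Function.Properties.Equivalence using () renaming (trans to ⇔-trans)
open import Relation.Binary.PropositionalEquality
open import Relation.Nullary using (¬_)

Decomposition : (ℕ → Set) → ℕ → ℕ → Set
Decomposition R n s = ∃₂ λ x t → R t × x * n + t ≡ s

Decomposition-+ : ∀ {R n g} → (∀ {t} → R t → Decomposition R n (g + t)) →
                  ∀ {s} → Decomposition R n s → Decomposition R n (g + s)
Decomposition-+ {n = n} {g} step (x , t , r , refl) with step r
... | x′ , t′ , r′ , x′n+t′≡g+t = x + x′ , t′ , r′ , (begin
  (x + x′) * n + t′      ≡⟨ cong (_+ t′) (*-distribʳ-+ n x x′) ⟩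
  x * n + x′ * n + t′    ≡⟨ +-assoc (x * n) (x′ * n) t′ ⟩
  x * n + (x′ * n + t′)  ≡⟨ cong (x * n +_) x′n+t′≡g+t ⟩
  x * n + (g + t)        ≡⟨ x∙yz≈y∙xz (x * n) g t ⟩
  g + (x * n + t)        ∎)
  where open ≡-Reasoning

apery-by-representatives : {S R : ℕ → Set} {n : ℕ} →
  (∀ x {t} → R t → S (x * n + t)) →
  (∀ {s} → S s → Decomposition R n s) →
  (∀ x {t t′} → R t → R t′ → t ≢ suc x * n + t′) →
  ∀ s → InApery S n s ⇔ R s
apery-by-representatives {S} {R} {n} shift-∈ decompose separated s = mk⇔ to from
  where
  open ≡-Reasoning

  to : InApery S n s → R s
  to (s∈S , s∉n+S) with decompose s∈S
  ... | zero  , t , r , refl = r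
  ... | suc x , t , r , refl = ⊥-elim (s∉n+S (n≤s , subst S (sym s∸n≡xn+t) (shift-∈ x r)))
    where
    n≤s : n ≤ suc x * n + t
    n≤s = ≤-trans (m≤m+n n (x * n)) (m≤m+n (suc x * n) t)
    s∸n≡xn+t : suc x * n + t ∸ n ≡ x * n + t
    s∸n≡xn+t = trans (cong (_∸ n) (+-assoc n (x * n) t)) (m+n∸m≡n n (x * n + t))

  from : R s → InApery S n s
  from r = shift-∈ 0 r , s∉n+S
    where
    s∉n+S : ¬ (n ≤ s × S (s ∸ n))
    s∉n+S (n≤s , s∸n∈S) with decompose s∸n∈S
    ... | x , t , r′ , xn+t≡s∸n = separated x r r′ (begin
      s                ≡⟨ sym (m+[n∸m]≡n n≤s) ⟩
      n + (s ∸ n)      ≡⟨ cong (n +_) (sym xn+t≡s∸n) ⟩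
      n + (x * n + t)  ≡⟨ sym (+-assoc n (x * n) t) ⟩
      suc x * n + t    ∎)

InGen3-induction : ∀ {a b c} (P : ℕ → Set) → P 0 →
  (∀ {s} → P s → P (a + s)) → (∀ {s} → P s → P (b + s)) → (∀ {s} → P s → P (c + s)) →
  ∀ {s} → InGen3 a b c s → P s
InGen3-induction {a} {b} {c} P p0 pa pb pc (x , y , z , refl) =
  subst P regroup (iterate pa x (iterate pb y (iterate pc z p0)))
  where
  iterate : ∀ {g} → (∀ {s} → P s → P (g + s)) → ∀ m {s} → P s → P (m * g + s)
  iterate step zero    ps = ps
  iterate {g} step (suc m) {s} ps =
    subst P (sym (+-assoc g (m * g) s)) (step (iterate step m ps))

  regroup : x * a + (y * b + (z * c + 0)) ≡ x * a + y * b + z * c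
  regroup = trans (cong (λ w → x * a + (y * b + w)) (+-identityʳ (z * c)))
                  (sym (+-assoc (x * a) (y * b) (z * c)))

division-unique : ∀ {n} .{{_ : NonZero n}} {q q′ r r′} → r < n → r′ < n →
                  r + q * n ≡ r′ + q′ * n → r ≡ r′ × q ≡ q′
division-unique {n} {q} {q′} {r} {r′} r<n r′<n eq =
  r≡r′ , *-cancelʳ-≡ q q′ n (+-cancelˡ-≡ r′ _ _ (trans (cong (_+ q * n) (sym r≡r′)) eq))
  where
  open ≡-Reasoning
  r≡r′ : r ≡ r′
  r≡r′ = begin
    r                ≡⟨ sym (m<n⇒m%n≡m r<n) ⟩
    r % n            ≡⟨ sym ([m+kn]%n≡m%n r q n) ⟩
    (r + q * n) % n  ≡⟨ cong (_% n) eq ⟩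
    (r′ + q′ * n) % n ≡⟨ [m+kn]%n≡m%n r′ q′ n ⟩
    r′ % n           ≡⟨ m<n⇒m%n≡m r′<n ⟩
    r′               ∎

odd-expansion-unique : ∀ {n} h → n ≡ suc (2 * h) → ∀ P Q {u v} → u < n → v < n →
                       P * n + 2 * u ≡ Q * n + 2 * v → P ≡ Q × u ≡ v
odd-expansion-unique {n} h refl = unique
  where
  2u≢[1+Q]n+2v : ∀ Q {u v} → u < n → 2 * u ≢ suc Q * n + 2 * v
  2u≢[1+Q]n+2v zero {u} {v} _ eq = even≢odd u (h + v) (trans eq (solve (h ∷ v ∷ [])))
  2u≢[1+Q]n+2v (suc Q) {u} {v} u<n eq = <-irrefl eq (begin-strict
    2 * u                          <⟨ *-monoʳ-< 2 u<n ⟩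
    n + (n + 0)                    ≤⟨ +-monoʳ-≤ n (+-monoʳ-≤ n z≤n) ⟩
    suc (suc Q) * n                ≤⟨ m≤m+n (suc (suc Q) * n) (2 * v) ⟩
    suc (suc Q) * n + 2 * v        ∎)
    where open ≤-Reasoning

  unique : ∀ P Q {u v} → u < n → v < n → P * n + 2 * u ≡ Q * n + 2 * v → P ≡ Q × u ≡ v
  unique zero    zero            _   _   eq = refl , *-cancelˡ-≡ _ _ 2 eq
  unique zero    (suc Q) {v = v} u<n _   eq = ⊥-elim (2u≢[1+Q]n+2v Q {v = v} u<n eq)
  unique (suc P) zero    {u = u} _   v<n eq = ⊥-elim (2u≢[1+Q]n+2v P {v = u} v<n (sym eq))
  unique (suc P) (suc Q) {u} {v} u<n v<n eq
    with unique P Q u<n v<n (+-cancelˡ-≡ n _ _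
           (trans (sym (+-assoc n (P * n) (2 * u))) (trans eq (+-assoc n (Q * n) (2 * v)))))
  ... | P≡Q , u≡v = cong suc P≡Q , u≡v

module Generators (k : ℕ) where

  -- INLINE lets the ring solver see through these abbreviations.
  a b c : ℕ
  a = 6 * k + 5
  b = 6 * k + 7
  c = 6 * k + 11
  {-# INLINE a #-}
  {-# INLINE b #-}
  {-# INLINE c #-}

  element : ℕ → ℕ → ℕ
  element y z = y * b + z * c
  {-# INLINE element #-}

  data Reduced : ℕ → ℕ → Set where
    reduced₀ : ∀ {z} → z ≤ 1 + 2 * k → Reduced 0 z
    reduced₁ : ∀ {z} → z ≤ 1 + 2 * k → Reduced 1 z
    reduced₂ : ∀ {z} → z ≤ 2 * k → Reduced 2 z

  Representative : ℕ → Set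
  Representative t = ∃₂ λ y z → Reduced y z × element y z ≡ t

  3b+zc≡2a+[1+z]c : ∀ z → element 3 z ≡ 2 * a + element 0 (suc z)
  3b+zc≡2a+[1+z]c z = solve (k ∷ z ∷ [])

  yb+[2k+2]c≡[2k+3]a+[1+y]b : ∀ y →
    element y (2 + 2 * k) ≡ (3 + 2 * k) * a + element (suc y) 0
  yb+[2k+2]c≡[2k+3]a+[1+y]b y = solve (k ∷ y ∷ [])

  2b+[2k+1]c≡[2k+5]a : element 2 (1 + 2 * k) ≡ (5 + 2 * k) * a + element 0 0
  2b+[2k+1]c≡[2k+5]a = solve (k ∷ [])

  decomposed : ∀ x {y z s} → Reduced y z → x * a + element y z ≡ s →
               Decomposition Representative a s
  decomposed x {y} {z} red eq = x , element y z , (y , z , red , refl) , eq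

  add-b : ∀ {y z} → Reduced y z → Decomposition Representative a (element (suc y) z)
  add-b (reduced₀ p) = decomposed 0 (reduced₁ p) refl
  add-b (reduced₁ p) with m≤n⇒m<n∨m≡n p
  ... | inj₁ (s≤s p′) = decomposed 0 (reduced₂ p′) refl
  ... | inj₂ refl     = decomposed (5 + 2 * k) (reduced₀ z≤n) (sym 2b+[2k+1]c≡[2k+5]a)
  add-b (reduced₂ {z} p) = decomposed 2 (reduced₀ (s≤s p)) (sym (3b+zc≡2a+[1+z]c z))

  add-c : ∀ {y z} → Reduced y z → Decomposition Representative a (element y (suc z))
  add-c (reduced₀ p) with m≤n⇒m<n∨m≡n p
  ... | inj₁ p′   = decomposed 0 (reduced₀ p′) refl
  ... | inj₂ refl = decomposed (3 + 2 * k) (reduced₁ z≤n) (sym (yb+[2k+2]c≡[2k+3]a+[1+y]b 0))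
  add-c (reduced₁ p) with m≤n⇒m<n∨m≡n p
  ... | inj₁ p′   = decomposed 0 (reduced₁ p′) refl
  ... | inj₂ refl = decomposed (3 + 2 * k) (reduced₂ z≤n) (sym (yb+[2k+2]c≡[2k+3]a+[1+y]b 1))
  add-c (reduced₂ p) with m≤n⇒m<n∨m≡n p
  ... | inj₁ p′   = decomposed 0 (reduced₂ p′) refl
  ... | inj₂ refl = decomposed (5 + 2 * k) (reduced₀ z≤n) (sym 2b+[2k+1]c≡[2k+5]a)

  decompose : ∀ {s} → InGen3 a b c s → Decomposition Representative a s
  decompose = InGen3-induction (Decomposition Representative a)
    (decomposed 0 (reduced₀ z≤n) refl)
    (Decomposition-+ plus-a) (Decomposition-+ plus-b) (Decomposition-+ plus-c)
    where
    plus-a : ∀ {t} → Representative t → Decomposition Representative a (a + t)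
    plus-a (y , z , red , refl) = decomposed 1 red (cong (_+ element y z) (+-identityʳ a))
    plus-b : ∀ {t} → Representative t → Decomposition Representative a (b + t)
    plus-b (y , z , red , refl) =
      subst (Decomposition Representative a) (+-assoc b (y * b) (z * c)) (add-b red)
    plus-c : ∀ {t} → Representative t → Decomposition Representative a (c + t)
    plus-c (y , z , red , refl) =
      subst (Decomposition Representative a) (x∙yz≈y∙xz (y * b) c (z * c)) (add-c red)

  Reduced⇒y<3 : ∀ {y z} → Reduced y z → y < 3
  Reduced⇒y<3 (reduced₀ _) = s≤s z≤n
  Reduced⇒y<3 (reduced₁ _) = s≤s (s≤s z≤n)
  Reduced⇒y<3 (reduced₂ _) = ≤-refl

  y+z*3<a-if-z≤B : ∀ y B {z} d → z ≤ B → y + B * 3 + suc d ≡ a → y + z * 3 < a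
  y+z*3<a-if-z≤B y B d z≤B eq =
    ≤-<-trans (+-monoʳ-≤ y (*-monoˡ-≤ 3 z≤B)) (subst (y + B * 3 <_) eq (m<m+n (y + B * 3) z<s))

  Reduced⇒y+z*3<a : ∀ {y z} → Reduced y z → y + z * 3 < a
  Reduced⇒y+z*3<a (reduced₀ p) = y+z*3<a-if-z≤B 0 (1 + 2 * k) 1 p (solve (k ∷ []))
  Reduced⇒y+z*3<a (reduced₁ p) = y+z*3<a-if-z≤B 1 (1 + 2 * k) 0 p (solve (k ∷ []))
  Reduced⇒y+z*3<a (reduced₂ p) = y+z*3<a-if-z≤B 2 (2 * k) 2 p (solve (k ∷ []))

  a≡1+2[3k+2] : a ≡ 1 + 2 * (3 * k + 2)
  a≡1+2[3k+2] = solve (k ∷ [])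

  element≡[y+z]a+2[y+z*3] : ∀ y z → element y z ≡ (y + z) * a + 2 * (y + z * 3)
  element≡[y+z]a+2[y+z*3] y z = solve (k ∷ y ∷ z ∷ [])

  separated : ∀ x {t t′} → Representative t → Representative t′ → t ≢ suc x * a + t′
  separated x (y , z , red , refl) (y′ , z′ , red′ , refl) eq
    with odd-expansion-unique (3 * k + 2) a≡1+2[3k+2] (y + z) (suc x + (y′ + z′))
           (Reduced⇒y+z*3<a red) (Reduced⇒y+z*3<a red′) expanded
    where
    open ≡-Reasoning
    expanded : (y + z) * a + 2 * (y + z * 3) ≡ (suc x + (y′ + z′)) * a + 2 * (y′ + z′ * 3)
    expanded = begin
      (y + z) * a + 2 * (y + z * 3)                ≡⟨ sym (element≡[y+z]a+2[y+z*3] y z) ⟩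
      element y z                                  ≡⟨ eq ⟩
      suc x * a + element y′ z′                    ≡⟨ solve (k ∷ x ∷ y′ ∷ z′ ∷ []) ⟩
      (suc x + (y′ + z′)) * a + 2 * (y′ + z′ * 3)  ∎
  ... | y+z≡1+x+y′+z′ , y+z*3≡y′+z′*3
    with division-unique {q = z} {q′ = z′} (Reduced⇒y<3 red) (Reduced⇒y<3 red′) y+z*3≡y′+z′*3
  ... | refl , refl = m≢1+n+m (y + z) {x} y+z≡1+x+y′+z′

  apery-set : ∀ s → InApery (InGen3 a b c) a s ⇔ Representative s
  apery-set = apery-by-representatives
    (λ { x (y , z , _ , refl) → x , y , z , +-assoc (x * a) (y * b) (z * c) })
    decompose separated

  Listed : ℕ → Set
  Listed s = s ≡ 0 ⊎ s ≡ b ⊎ s ≡ c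
    ⊎ (∃ λ j → 2 ≤ j × j ≤ 2 * k + 1 × (s ≡ j * c ∸ 8 ⊎ s ≡ j * c ∸ 4 ⊎ s ≡ j * c))
    ⊎ s ≡ (2 * k + 2) * c ∸ 8
    ⊎ s ≡ (2 * k + 2) * c ∸ 4

  element+4y≡[y+z]c : ∀ y z → element y z + 4 * y ≡ (y + z) * c
  element+4y≡[y+z]c y z = solve (k ∷ y ∷ z ∷ [])

  element≡jc∸4y : ∀ y z {j} → y + z ≡ j → element y z ≡ j * c ∸ 4 * y
  element≡jc∸4y y z refl =
    trans (sym (m+n∸n≡m (element y z) (4 * y))) (cong (_∸ 4 * y) (element+4y≡[y+z]c y z))

  2+2k≡2k+2 : 2 + 2 * k ≡ 2 * k + 2
  2+2k≡2k+2 = +-comm 2 (2 * k)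

  middle⇒Listed : ∀ {s} j → 2 ≤ j → j ≤ 1 + 2 * k →
                  s ≡ j * c ∸ 8 ⊎ s ≡ j * c ∸ 4 ⊎ s ≡ j * c → Listed s
  middle⇒Listed j 2≤j j≤1+2k s≡ =
    inj₂ (inj₂ (inj₂ (inj₁ (j , 2≤j , subst (j ≤_) (+-comm 1 (2 * k)) j≤1+2k , s≡))))

  Reduced⇒Listed : ∀ {y z} → Reduced y z → Listed (element y z)
  Reduced⇒Listed (reduced₀ {zero} _) = inj₁ refl
  Reduced⇒Listed (reduced₀ {1} _) = inj₂ (inj₂ (inj₁ (+-identityʳ c)))
  Reduced⇒Listed (reduced₀ {suc (suc i)} p) =
    middle⇒Listed (2 + i) (s≤s (s≤s z≤n)) p (inj₂ (inj₂ (element≡jc∸4y 0 (2 + i) refl)))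
  Reduced⇒Listed (reduced₁ {zero} _) = inj₂ (inj₁ (trans (+-identityʳ _) (+-identityʳ b)))
  Reduced⇒Listed (reduced₁ {suc i} p) with m≤n⇒m<n∨m≡n p
  ... | inj₁ 2+i≤1+2k =
    middle⇒Listed (2 + i) (s≤s (s≤s z≤n)) 2+i≤1+2k (inj₂ (inj₁ (element≡jc∸4y 1 (suc i) refl)))
  ... | inj₂ refl     = inj₂ (inj₂ (inj₂ (inj₂ (inj₂ (element≡jc∸4y 1 (1 + 2 * k) 2+2k≡2k+2)))))
  Reduced⇒Listed (reduced₂ {z} p) with m≤n⇒m<n∨m≡n p
  ... | inj₁ 1+z≤2k =
    middle⇒Listed (2 + z) (s≤s (s≤s z≤n)) (s≤s 1+z≤2k) (inj₁ (element≡jc∸4y 2 z refl))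
  ... | inj₂ refl   = inj₂ (inj₂ (inj₂ (inj₂ (inj₁ (element≡jc∸4y 2 (2 * k) 2+2k≡2k+2)))))

  middle⇒Representative : ∀ {s} j → 2 ≤ j → j ≤ 1 + 2 * k →
                          s ≡ j * c ∸ 8 ⊎ s ≡ j * c ∸ 4 ⊎ s ≡ j * c → Representative s
  middle⇒Representative 1 (s≤s ()) _ _
  middle⇒Representative (suc (suc i)) _ j≤1+2k (inj₁ refl) =
    2 , i , reduced₂ (<⇒≤ (s≤s⁻¹ j≤1+2k)) , element≡jc∸4y 2 i refl
  middle⇒Representative (suc (suc i)) _ j≤1+2k (inj₂ (inj₁ refl)) =
    1 , suc i , reduced₁ (<⇒≤ j≤1+2k) , element≡jc∸4y 1 (suc i) refl
  middle⇒Representative (suc (suc i)) _ j≤1+2k (inj₂ (inj₂ refl)) =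
    0 , 2 + i , reduced₀ j≤1+2k , element≡jc∸4y 0 (2 + i) refl

  Listed⇒Representative : ∀ {s} → Listed s → Representative s
  Listed⇒Representative (inj₁ refl) = 0 , 0 , reduced₀ z≤n , refl
  Listed⇒Representative (inj₂ (inj₁ refl)) =
    1 , 0 , reduced₁ z≤n , trans (+-identityʳ _) (+-identityʳ b)
  Listed⇒Representative (inj₂ (inj₂ (inj₁ refl))) = 0 , 1 , reduced₀ (s≤s z≤n) , +-identityʳ c
  Listed⇒Representative (inj₂ (inj₂ (inj₂ (inj₁ (j , 2≤j , j≤2k+1 , s≡))))) =
    middle⇒Representative j 2≤j (subst (j ≤_) (+-comm (2 * k) 1) j≤2k+1) s≡
  Listed⇒Representative (inj₂ (inj₂ (inj₂ (inj₂ (inj₁ refl))))) =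
    2 , 2 * k , reduced₂ ≤-refl , element≡jc∸4y 2 (2 * k) 2+2k≡2k+2
  Listed⇒Representative (inj₂ (inj₂ (inj₂ (inj₂ (inj₂ refl))))) =
    1 , 1 + 2 * k , reduced₁ ≤-refl , element≡jc∸4y 1 (1 + 2 * k) 2+2k≡2k+2

  Representative⇔Listed : ∀ s → Representative s ⇔ Listed s
  Representative⇔Listed s =
    mk⇔ (λ { (y , z , red , refl) → Reduced⇒Listed red }) Listed⇒Representative

corollary9 : (k : ℕ) → (s : ℕ) →
    InApery (InGen3 (6 * k + 5) (6 * k + 7) (6 * k + 11)) (6 * k + 5) s
    ⇔ (s ≡ 0 ⊎ s ≡ 6 * k + 7 ⊎ s ≡ 6 * k + 11
       ⊎ (∃ λ j → 2 ≤ j × j ≤ 2 * k + 1 ×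
            (s ≡ j * (6 * k + 11) ∸ 8 ⊎ s ≡ j * (6 * k + 11) ∸ 4 ⊎ s ≡ j * (6 * k + 11)))
       ⊎ s ≡ (2 * k + 2) * (6 * k + 11) ∸ 8
       ⊎ s ≡ (2 * k + 2) * (6 * k + 11) ∸ 4)
corollary9 k s = ⇔-trans (apery-set s) (Representative⇔Listed s)
  where open Generators k
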